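{- Let $k,m$ be positive integers, $S_1,\dots,S_m\subseteq[k]\times[k]$ sets each containing at most one element from each row, and $G$ the graph constructed from them as described in the context. If there is a matching $M$ in $G$ with $|M|\ge 3k+m$ such that $G[V_M]$ has at least $k$ connected components, then there is a matching $\widetilde M$ in $G$ with $|\widetilde M|\ge 3k+m$ such that $G[V_{\widetilde M}]$ has at least $k$ connected components and every edge of $\widetilde M$ is of Type-I or Type-II.
   Context: A row of $[k]\times[k]$ is a set $\{i\}\times[k]$. Construction: let $P_i=\{i\}\times[k]$ for $i\in[k]$, and let $\mathcal{S}$ be the family consisting of the $m$ sets $S_1,\dots,S_m$ and the $k$ sets $P_1,\dots,P_k$ (treated as $k+m$ distinct members). The graph $H$ has vertices $v_i^L$ ($i\in[k]$), $v_j^R$ ($j\in[k]$), and for every $X\in\mathcal{S}$ and $(i,j)\in X$ a vertex $v_{i,j}^X$; its edges are $v_i^Lv_{i,j}^X$ and $v_{i,j}^Xv_j^R$ for all $X\in\mathcal{S}$ and $(i,j)\in X$. The graph $G$ is obtained from $H$ by adding, for each $i\in[k]$, a new vertex $u_i^L$ adjacent only to $v_i^L$; for each $j\in[k]$, a new vertex $u_j^R$ adjacent only to $v_j^R$; and for each $X\in\mathcal{S}$, a new vertex $u^X$ adjacent exactly to the vertices $v_{i,j}^X$, $(i,j)\in X$. Type-I edges are $v_i^Lu_i^L$ ($i\in[k]$) and $v_j^Ru_j^R$ ($j\in[k]$); Type-II edges are $v_{i,j}^Xu^X$ ($X\in\mathcal{S}$, $(i,j)\in X$); Type-III edges are the edges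 of $H$. For a matching $M$ (set of pairwise disjoint edges), $V_M$ is the set of endpoints of its edges and $G[V_M]$ the induced subgraph. -}

module Defs where

open import Data.Nat using (ℕ; _+_; _*_; _≤_)
open import Data.Fin using (Fin; _≟_)
open import Data.Bool using (Bool; true; false)
open import Data.Sum using (_⊎_; inj₁; inj₂)
open import Data.Product using (Σ; _×_; _,_; ∃-syntax)
open import Data.List using (List; length)
open import Data.List.Membership.Propositional using (_∈_)
open import Data.List.Relation.Unary.AllPairs using (AllPairs)
open import Relation.Nullary using (¬_; does)
open import Relation.Binary.PropositionalEquality using (_≡_; _≢_)

SubsetSq : ℕ → Set
SubsetSq k = Fin k → Fin k → Bool

AtMostOnePerRow : ∀ {k} → SubsetSq k → Set
AtMostOnePerRow {k} S = ∀ (i j j' : Fin k) → S i j ≡ true → S i j' ≡ true → j ≡ j'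

module Construction {k m : ℕ} (S : Fin m → SubsetSq k) where

  -- Index set of the family 𝒮 : the m sets S_1..S_m (inj₁) and the k rows P_1..P_k (inj₂),
  -- treated as k+m distinct members.
  Idx : Set
  Idx = Fin m ⊎ Fin k

  mem : Idx → Fin k → Fin k → Bool
  mem (inj₁ s) i j = S s i j
  mem (inj₂ p) i j = does (i ≟ p)

  data V : Set where
    vL : Fin k → V
    vR : Fin k → V
    vX : (X : Idx) (i j : Fin k) → mem X i j ≡ true → V
    uL : Fin k → V
    uR : Fin k → V
    uX : Idx → V

  -- Edges of G (each edge listed once, with a fixed orientation)
  data Edge : V → V → Set where
    eIL   : (i : Fin k) → Edge (vL i) (uL i)
    eIR   : (j : Fin k) → Edge (vR j) (uR j)
    eII   : (X : Idx) (i j : Fin k) (p : mem X i j ≡ true) → Edge (vX X i j p) (uX X)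
    eIIIL : (X : Idx) (i j : Fin k) (p : mem X i j ≡ true) → Edge (vL i) (vX X i j p)
    eIIIR : (X : Idx) (i j : Fin k) (p : mem X i j ≡ true) → Edge (vX X i j p) (vR j)

  Adj : V → V → Set
  Adj u v = Edge u v ⊎ Edge v u

  GEdge : Set
  GEdge = Σ V λ u → Σ V λ v → Edge u v

  IsEndpoint : V → GEdge → Set
  IsEndpoint w (u , v , _) = (w ≡ u) ⊎ (w ≡ v)

  DisjointEdges : GEdge → GEdge → Set
  DisjointEdges e f = ∀ w → IsEndpoint w e → ¬ IsEndpoint w f

  IsMatching : List GEdge → Set
  IsMatching M = AllPairs DisjointEdges M

  InVM : List GEdge → V → Set
  InVM M w = ∃[ e ] (e ∈ M × IsEndpoint w e)

  data Reach (M : List GEdge) : V → V → Set where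
    here : ∀ {u} → InVM M u → Reach M u u
    step : ∀ {u v w} → Reach M u v → Adj v w → InVM M w → Reach M u w

  AtLeastComponents : ℕ → List GEdge → Set
  AtLeastComponents n M =
    Σ (Fin n → V) λ f → ((∀ (a : Fin n) → InVM M (f a)) ×
            (∀ (a b : Fin n) → a ≢ b → ¬ Reach M (f a) (f b)))

  data TypeIorII : GEdge → Set where
    tIL : ∀ i → TypeIorII (vL i , uL i , eIL i)
    tIR : ∀ j → TypeIorII (vR j , uR j , eIR j)
    tII : ∀ X i j p → TypeIorII (vX X i j p , uX X , eII X i j p)

-- Replace every Type-III edge of M by the Type-I edge at its endpoint v_i^L or v_j^R.
-- Since u_i^L and u_j^R are pendant vertices, the result is again a matching of the
-- same size.  Collapsing each pendant u onto its neighbour turns every path of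
-- G[V_M̃] into a path of G[V_M], and every vertex of V_M is joined inside G[V_M] to
-- an endpoint kept by the replacement; so k vertices of V_M in distinct components
-- yield k such vertices for M̃.
module Submission where

open import Defs
open import Data.Nat using (ℕ; _+_; _*_; _≤_; NonZero)
open import Data.Fin using (Fin)
open import Data.Product using (_×_; ∃-syntax; _,_; proj₁; proj₂)
open import Data.Sum using (_⊎_; inj₁; inj₂)
open import Data.List using (List; length; map)
open import Data.List.Membership.Propositional using (_∈_)
open import Data.List.Membership.Propositional.Properties using (∈-map⁺; ∈-map⁻)
open import Data.List.Properties using (length-map)
open import Data.List.Relation.Unary.All using (All)
import Data.List.Relation.Unary.All as All
import Data.List.Relation.Unary.All.Properties as All
import Data.List.Relation.Unary.AllPairs as AllPairs
import Data.List.Relation.Unary.AllPairs.Properties as AllPairs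
open import Relation.Binary.PropositionalEquality using (_≡_; refl; sym; subst)

module _ {k m : ℕ} (S : Fin m → SubsetSq k) where
  open Construction S

  Adj-sym : ∀ {u v} → Adj u v → Adj v u
  Adj-sym (inj₁ e) = inj₂ e
  Adj-sym (inj₂ e) = inj₁ e

  Reach-endpoints : ∀ {M u v} → Reach M u v → InVM M u × InVM M v
  Reach-endpoints (here u∈) = u∈ , u∈
  Reach-endpoints (step r _ w∈) = proj₁ (Reach-endpoints r) , w∈

  Reach-trans : ∀ {M u v w} → Reach M u v → Reach M v w → Reach M u w
  Reach-trans r (here _) = r
  Reach-trans r (step s a w∈) = step (Reach-trans r s) a w∈

  Reach-sym : ∀ {M u v} → Reach M u v → Reach M v u
  Reach-sym (here u∈) = here u∈
  Reach-sym (step r a w∈) =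
    Reach-trans (step (here w∈) (Adj-sym a) (proj₂ (Reach-endpoints r))) (Reach-sym r)

  Reach-edge : ∀ {M} e → e ∈ M → ∀ {a b} → IsEndpoint a e → IsEndpoint b e → Reach M a b
  Reach-edge (u , v , uv) e∈ (inj₁ refl) (inj₁ refl) = here (_ , e∈ , inj₁ refl)
  Reach-edge (u , v , uv) e∈ (inj₁ refl) (inj₂ refl) =
    step (here (_ , e∈ , inj₁ refl)) (inj₁ uv) (_ , e∈ , inj₂ refl)
  Reach-edge (u , v , uv) e∈ (inj₂ refl) (inj₁ refl) =
    step (here (_ , e∈ , inj₂ refl)) (inj₂ uv) (_ , e∈ , inj₁ refl)
  Reach-edge (u , v , uv) e∈ (inj₂ refl) (inj₂ refl) = here (_ , e∈ , inj₂ refl)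

  collapse : V → V
  collapse (uL i) = vL i
  collapse (uR j) = vR j
  collapse v      = v

  collapse-Edge : ∀ {u v} → Edge u v → (collapse u ≡ collapse v) ⊎ Edge (collapse u) (collapse v)
  collapse-Edge (eIL i)         = inj₁ refl
  collapse-Edge (eIR j)         = inj₁ refl
  collapse-Edge (eII X i j p)   = inj₂ (eII X i j p)
  collapse-Edge (eIIIL X i j p) = inj₂ (eIIIL X i j p)
  collapse-Edge (eIIIR X i j p) = inj₂ (eIIIR X i j p)

  collapse-Adj : ∀ {u v} → Adj u v → (collapse u ≡ collapse v) ⊎ Adj (collapse u) (collapse v)
  collapse-Adj (inj₁ uv) with collapse-Edge uv
  ... | inj₁ eq  = inj₁ eq
  ... | inj₂ uv′ = inj₂ (inj₁ uv′)
  collapse-Adj (inj₂ vu) with collapse-Edge vu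
  ... | inj₁ eq  = inj₁ (sym eq)
  ... | inj₂ vu′ = inj₂ (inj₂ vu′)

  toTypeIorII : GEdge → GEdge
  toTypeIorII (_ , _ , eIIIL X i j p) = (_ , _ , eIL i)
  toTypeIorII (_ , _ , eIIIR X i j p) = (_ , _ , eIR j)
  toTypeIorII e                       = e

  toTypeIorII-TypeIorII : ∀ e → TypeIorII (toTypeIorII e)
  toTypeIorII-TypeIorII (_ , _ , eIL i)         = tIL i
  toTypeIorII-TypeIorII (_ , _ , eIR j)         = tIR j
  toTypeIorII-TypeIorII (_ , _ , eII X i j p)   = tII X i j p
  toTypeIorII-TypeIorII (_ , _ , eIIIL X i j p) = tIL i
  toTypeIorII-TypeIorII (_ , _ , eIIIR X i j p) = tIR j

  collapse-IsEndpoint :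
    ∀ e w → IsEndpoint w (toTypeIorII e) → IsEndpoint (collapse w) e
  collapse-IsEndpoint (_ , _ , eIL i)         _ (inj₁ refl) = inj₁ refl
  collapse-IsEndpoint (_ , _ , eIL i)         _ (inj₂ refl) = inj₁ refl
  collapse-IsEndpoint (_ , _ , eIR j)         _ (inj₁ refl) = inj₁ refl
  collapse-IsEndpoint (_ , _ , eIR j)         _ (inj₂ refl) = inj₁ refl
  collapse-IsEndpoint (_ , _ , eII X i j p)   _ (inj₁ refl) = inj₁ refl
  collapse-IsEndpoint (_ , _ , eII X i j p)   _ (inj₂ refl) = inj₂ refl
  collapse-IsEndpoint (_ , _ , eIIIL X i j p) _ (inj₁ refl) = inj₁ refl
  collapse-IsEndpoint (_ , _ , eIIIL X i j p) _ (inj₂ refl) = inj₁ refl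
  collapse-IsEndpoint (_ , _ , eIIIR X i j p) _ (inj₁ refl) = inj₂ refl
  collapse-IsEndpoint (_ , _ , eIIIR X i j p) _ (inj₂ refl) = inj₂ refl

  DisjointEdges-toTypeIorII : ∀ {e f} → DisjointEdges e f → DisjointEdges (toTypeIorII e) (toTypeIorII f)
  DisjointEdges-toTypeIorII {e} {f} e#f w w∈e w∈f =
    e#f (collapse w) (collapse-IsEndpoint e w w∈e)
                     (collapse-IsEndpoint f w w∈f)

  -- The endpoint of e that toTypeIorII keeps and collapse fixes.
  keptEndpoint : GEdge → V
  keptEndpoint (_ , _ , eIL i)         = vL i
  keptEndpoint (_ , _ , eIR j)         = vR j
  keptEndpoint (_ , _ , eII X i j p)   = vX X i j p
  keptEndpoint (_ , _ , eIIIL X i j p) = vL i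
  keptEndpoint (_ , _ , eIIIR X i j p) = vR j

  keptEndpoint-IsEndpoint : ∀ e → IsEndpoint (keptEndpoint e) e
  keptEndpoint-IsEndpoint (_ , _ , eIL i)         = inj₁ refl
  keptEndpoint-IsEndpoint (_ , _ , eIR j)         = inj₁ refl
  keptEndpoint-IsEndpoint (_ , _ , eII X i j p)   = inj₁ refl
  keptEndpoint-IsEndpoint (_ , _ , eIIIL X i j p) = inj₁ refl
  keptEndpoint-IsEndpoint (_ , _ , eIIIR X i j p) = inj₂ refl

  keptEndpoint-IsEndpoint-toTypeIorII : ∀ e → IsEndpoint (keptEndpoint e) (toTypeIorII e)
  keptEndpoint-IsEndpoint-toTypeIorII (_ , _ , eIL i)         = inj₁ refl
  keptEndpoint-IsEndpoint-toTypeIorII (_ , _ , eIR j)         = inj₁ refl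
  keptEndpoint-IsEndpoint-toTypeIorII (_ , _ , eII X i j p)   = inj₁ refl
  keptEndpoint-IsEndpoint-toTypeIorII (_ , _ , eIIIL X i j p) = inj₁ refl
  keptEndpoint-IsEndpoint-toTypeIorII (_ , _ , eIIIR X i j p) = inj₁ refl

  collapse-keptEndpoint : ∀ e → collapse (keptEndpoint e) ≡ keptEndpoint e
  collapse-keptEndpoint (_ , _ , eIL i)         = refl
  collapse-keptEndpoint (_ , _ , eIR j)         = refl
  collapse-keptEndpoint (_ , _ , eII X i j p)   = refl
  collapse-keptEndpoint (_ , _ , eIIIL X i j p) = refl
  collapse-keptEndpoint (_ , _ , eIIIR X i j p) = refl

  collapse-InVM : ∀ {M w} → InVM (map toTypeIorII M) w → InVM M (collapse w)
  collapse-InVM {w = w} (_ , e′∈ , w∈e′) with ∈-map⁻ toTypeIorII e′∈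
  ... | e , e∈ , refl = e , e∈ , collapse-IsEndpoint e w w∈e′

  collapse-Reach :
    ∀ {M x y} → Reach (map toTypeIorII M) x y → Reach M (collapse x) (collapse y)
  collapse-Reach (here x∈) = here (collapse-InVM x∈)
  collapse-Reach (step r a z∈) with collapse-Adj a
  ... | inj₁ eq = subst (Reach _ _) eq (collapse-Reach r)
  ... | inj₂ a′ = step (collapse-Reach r) a′ (collapse-InVM z∈)

  InVM-reaches-map-toTypeIorII :
    ∀ {M w} → InVM M w → ∃[ w′ ] (InVM (map toTypeIorII M) w′ × Reach M w (collapse w′))
  InVM-reaches-map-toTypeIorII (e , e∈ , w∈e) =
    keptEndpoint e ,
    (toTypeIorII e , ∈-map⁺ toTypeIorII e∈ , keptEndpoint-IsEndpoint-toTypeIorII e) ,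
    subst (Reach _ _) (sym (collapse-keptEndpoint e)) (Reach-edge e e∈ w∈e (keptEndpoint-IsEndpoint e))

  IsMatching-map-toTypeIorII : ∀ {M} → IsMatching M → IsMatching (map toTypeIorII M)
  IsMatching-map-toTypeIorII M-matching =
    AllPairs.map⁺ (AllPairs.map (λ {e} {f} → DisjointEdges-toTypeIorII {e} {f}) M-matching)

  AtLeastComponents-map-toTypeIorII :
    ∀ {n M} → AtLeastComponents n M → AtLeastComponents n (map toTypeIorII M)
  AtLeastComponents-map-toTypeIorII {M = M} (f , f∈ , f-apart) =
    (λ a → proj₁ (rep a)) , (λ a → proj₁ (proj₂ (rep a))) , λ a b a≢b r →
      f-apart a b a≢b
        (Reach-trans (proj₂ (proj₂ (rep a)))
          (Reach-trans (collapse-Reach r) (Reach-sym (proj₂ (proj₂ (rep b))))))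
    where
    rep : ∀ a → ∃[ w′ ] (InVM (map toTypeIorII M) w′ × Reach M (f a) (collapse w′))
    rep a = InVM-reaches-map-toTypeIorII (f∈ a)

lemma8 : (k m : ℕ) → .{{NonZero k}} → .{{NonZero m}} →
    (S : Fin m → SubsetSq k) → (∀ s → AtMostOnePerRow (S s)) →
    let open Construction S in
    (∃[ M ] (IsMatching M × 3 * k + m ≤ length M × AtLeastComponents k M)) →
    ∃[ M′ ] (IsMatching M′ × 3 * k + m ≤ length M′ × AtLeastComponents k M′ × All TypeIorII M′)
lemma8 k m S _ (M , M-matching , size , components) =
  map (toTypeIorII S) M ,
  IsMatching-map-toTypeIorII S M-matching ,
  subst (3 * k + m ≤_) (sym (length-map (toTypeIorII S) M)) size ,
  AtLeastComponents-map-toTypeIorII S components ,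
  All.map⁺ (All.universal (toTypeIorII-TypeIorII S) M)
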